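{- Let $A$ be a setoid and $B$ a setoid family over $A$. There is an extensional function $\mathsf{us}:W\Rightarrow P_BW$ such that $\mathsf{s}\circ\mathsf{us}\approx\mathrm{id}_W$ and $\mathsf{us}\circ\mathsf{s}\approx\mathrm{id}_{P_BW}$.
   Context: Setting: intensional Martin-Löf type theory with $\Pi$-types and a universe $\mathsf{U}$ closed under $\Pi$ and containing intensional $\Sigma$-types, identity types, the unit type, W-types and dependent W-types; logic is propositions-as-types. A setoid $X$ is a tuple $(X_0,\approx_X,r_X,s_X,t_X)$ with $X_0:\mathsf{U}$, $\approx_X:X_0\to X_0\to\mathsf{U}$ and witnesses of reflexivity, symmetry, transitivity; $x:X$ means $x:X_0$. An extensional function $f:X\Rightarrow Y$ is $f_0:X_0\to Y_0$ with a proof of $\prod_{x,x'}x\approx x'\to f_0x\approx f_0x'$; the setoid $X\Rightarrow Y$ has $f\approx g:=\prod_x f_0x\approx g_0x$. A setoid family $B$ over a setoid $A$ gives a setoid $B\,a$ (underlying type $B_0a$) for $a:A$ and extensional transports $B_\alpha:B\,a\Rightarrow B\,a'$ for $\alpha:a\approx_Aa'$, functorial up to $\approx$, with $B_\alpha\approx B_{\alpha'}$ for all $\alpha,\alpha':a\approx a'$. Write $b\approx_\alpha b'$ for $B_\alpha b\approx b'$. $P_BX$ is the setoid on $\sum_{a:A_0}(B\,a\Rightarrow X)$ with $(a,k)\approx(a',k'):=\sum_{\alpha:a\approx a'}k\approx k'\circ B_\alpha$. $\mathrm{W}$ is the W-type on $A_0,B_0$ with constructor $\mathsf{sup}\,a\,f$,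 and $\mathsf{n}(\mathsf{sup}\,a\,f)\equiv a$, $\mathsf{b}(\mathsf{sup}\,a\,f)\equiv f$. $\mathcal{W}_B:\mathrm{W}\to\mathrm{W}\to\mathsf{U}$ is the inductive family with single constructor $\mathsf{dsup}\,(w,w')\,\alpha\,\phi:\mathcal{W}_B\,w\,w'$ for $\alpha:\mathsf{n}w\approx_A\mathsf{n}w'$ and $\phi:\prod_{(b,b',\beta):\sum_{b,b'}b\approx_\alpha b'}\mathcal{W}_B(\mathsf{b}\,w\,b)(\mathsf{b}\,w'\,b')$. The setoid $W$ has underlying type $\sum_{w:\mathrm{W}}\mathcal{W}_B\,w\,w$ and $(w,\_)\approx_W(w',\_):=\mathcal{W}_B\,w\,w'$. The algebra map $\mathsf{s}:P_BW\Rightarrow W$ sends $(a,f)$ to the tree $\mathsf{sup}\,a\,(\lambda b.\mathrm{pr}_1(f_0\,b))$ together with a proof that it lies in $W$ (i.e. a term of $\mathcal{W}_B$ on it twice). -}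

module Defs where

open import Level using (0ℓ)
open import Data.Product using (Σ; Σ-syntax; _,_; proj₁; proj₂)
open import Relation.Binary.Bundles using (Setoid)
open import Function.Bundles using (Func)
import Function.Construct.Composition as Comp
import Function.Construct.Identity as Ident
import Function.Relation.Binary.Setoid.Equality as FunEq

_⇒ₛ_ : Setoid 0ℓ 0ℓ → Setoid 0ℓ 0ℓ → Setoid 0ℓ 0ℓ
X ⇒ₛ Y = FunEq._⇨_ X Y

_≈ₑ_ : {X Y : Setoid 0ℓ 0ℓ} → Func X Y → Func X Y → Set
_≈ₑ_ {X} {Y} f g = Setoid._≈_ (X ⇒ₛ Y) f g

_∘ₛ_ : {X Y Z : Setoid 0ℓ 0ℓ} → Func Y Z → Func X Y → Func X Z
g ∘ₛ f = Comp.function f g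

idₛ : (X : Setoid 0ℓ 0ℓ) → Func X X
idₛ X = Ident.function X

record SetoidFamily (A : Setoid 0ℓ 0ℓ) : Set₁ where
  open Setoid A renaming (Carrier to A₀; _≈_ to _≈A_)
  field
    fam     : A₀ → Setoid 0ℓ 0ℓ
    tr      : {a a' : A₀} → a ≈A a' → Func (fam a) (fam a')
    tr-refl  : {a : A₀} → tr (Setoid.refl A {a}) ≈ₑ idₛ (fam a)
    tr-trans : {a a' a'' : A₀} (α : a ≈A a') (α' : a' ≈A a'') →
               tr (Setoid.trans A α α') ≈ₑ (tr α' ∘ₛ tr α)
    tr-irr   : {a a' : A₀} (α α' : a ≈A a') → tr α ≈ₑ tr α'

module _ {A : Setoid 0ℓ 0ℓ} (B : SetoidFamily A) where
  open Setoid A renaming (Carrier to A₀; _≈_ to _≈A_)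
  open SetoidFamily B

  B₀ : A₀ → Set
  B₀ a = Setoid.Carrier (fam a)

  _≈[_]_ : {a a' : A₀} → B₀ a → a ≈A a' → B₀ a' → Set
  b ≈[ α ] b' = Setoid._≈_ (fam _) (Func.to (tr α) b) b'

  private
    trId : {a : A₀} (α : a ≈A a) (b : B₀ a) → Setoid._≈_ (fam a) (Func.to (tr α) b) b
    trId {a} α b = Setoid.trans (fam a) (tr-irr α (Setoid.refl A) b) (tr-refl b)

    trInv : {a a' : A₀} (α : a ≈A a') (b : B₀ a) (b' : B₀ a') →
            Setoid._≈_ (fam a) (Func.to (tr (Setoid.sym A α)) b') b →
            b ≈[ α ] b'
    trInv {a} {a'} α b b' β =
      Setoid.trans (fam a')
        (Setoid.sym (fam a') (Func.cong (tr α) β))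
        (Setoid.trans (fam a')
          (Setoid.sym (fam a') (tr-trans (Setoid.sym A α) α b'))
          (trId _ b'))

  P : Setoid 0ℓ 0ℓ → Setoid 0ℓ 0ℓ
  P X = record
    { Carrier = Σ[ a ∈ A₀ ] Func (fam a) X
    ; _≈_ = λ { (a , k) (a' , k') → Σ[ α ∈ a ≈A a' ] (k ≈ₑ (k' ∘ₛ tr α)) }
    ; isEquivalence = record
      { refl = λ { {a , k} → Setoid.refl A , λ b → Func.cong k (Setoid.sym (fam a) (tr-refl b)) }
      ; sym = λ { {a , k} {a' , k'} (α , e) → Setoid.sym A α , λ b' →
                  Setoid.sym X (Setoid.trans X (e (Func.to (tr (Setoid.sym A α)) b'))
                    (Func.cong k' (trInv α _ b' (Setoid.refl (fam a))))) }
      ; trans = λ { {a , k} {a' , k'} {a'' , k''} (α , e) (α' , e') → Setoid.trans A α α' , λ b →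
                  Setoid.trans X (e b) (Setoid.trans X (e' (Func.to (tr α) b))
                    (Func.cong k'' (Setoid.sym (fam a'') (tr-trans α α' b)))) }
      }
    }

  data 𝕎 : Set where
    sup : (a : A₀) → (B₀ a → 𝕎) → 𝕎

  n : 𝕎 → A₀
  n (sup a f) = a

  br : (w : 𝕎) → B₀ (n w) → 𝕎
  br (sup a f) = f

  data 𝒲 : 𝕎 → 𝕎 → Set where
    dsup : (w w' : 𝕎) (α : n w ≈A n w') →
           ((t : Σ[ b ∈ B₀ (n w) ] Σ[ b' ∈ B₀ (n w') ] (b ≈[ α ] b')) →
              𝒲 (br w (proj₁ t)) (br w' (proj₁ (proj₂ t)))) →
           𝒲 w w'

  𝒲-sym : {w w' : 𝕎} → 𝒲 w w' → 𝒲 w' w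
  𝒲-sym (dsup w w' α φ) = dsup w' w (Setoid.sym A α)
    (λ { (b' , b , β) → 𝒲-sym (φ (b , b' , trInv α b b' β)) })

  𝒲-trans : {w w' w'' : 𝕎} → 𝒲 w w' → 𝒲 w' w'' → 𝒲 w w''
  𝒲-trans (dsup w w' α φ) (dsup .w' w'' α' φ') = dsup w w'' (Setoid.trans A α α')
    (λ { (b , b'' , β) → 𝒲-trans (φ (b , Func.to (tr α) b , Setoid.refl (fam (n w'))))
           (φ' (Func.to (tr α) b , b'' ,
                Setoid.trans (fam (n w'')) (Setoid.sym (fam (n w'')) (tr-trans α α' b)) β)) })

  WS : Setoid 0ℓ 0ℓ
  WS = record
    { Carrier = Σ[ w ∈ 𝕎 ] 𝒲 w w
    ; _≈_ = λ x y → 𝒲 (proj₁ x) (proj₁ y)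
    ; isEquivalence = record
      { refl = λ { {w , p} → p }
      ; sym = 𝒲-sym
      ; trans = 𝒲-trans
      }
    }

  s : Func (P WS) WS
  s = record
    { to = λ { (a , f) → sup a (λ b → proj₁ (Func.to f b)) ,
                 dsup _ _ (Setoid.refl A)
                   (λ { (b , b' , β) → Func.cong f
                        (Setoid.trans (fam a) (Setoid.sym (fam a) (tr-refl b)) β) }) }
    ; cong = λ { {a , f} {a' , f'} (α , e) → dsup _ _ α
                 (λ { (b , b' , β) → 𝒲-trans (e b) (Func.cong f' β) }) }
    }

module Submission where

-- A proof p : 𝒲_B w w' that two trees are equal records an equality of their
-- root labels and, for every pair of related positions, an equality of the
-- corresponding subtrees.  Both round trips are then immediate: s ∘ us returns a tree whose
-- underlying W-element is literally w (so the proof p itself witnesses the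
-- equality), and us ∘ s returns a pair with the same label and the same
-- underlying subtrees as the one it was given, so reflexivity of P_B W
-- witnesses the equality.

open import Defs
open import Level using (0ℓ)
open import Data.Product using (Σ; _×_; _,_)
open import Relation.Binary.Bundles using (Setoid)
open import Function.Bundles using (Func)

module UnSup (A : Setoid 0ℓ 0ℓ) (B : SetoidFamily A) where
  open Setoid A using () renaming (Carrier to A₀; _≈_ to _≈A_)
  open SetoidFamily B

  -- Transport along any self-equality a ≈ a is (pointwise) the identity;
  -- this is how a well-formed tree relates a position to itself.
  tr-loop : {a : A₀} (α : a ≈A a) (b : B₀ B a) → Setoid._≈_ (fam a) (Func.to (tr α) b) b
  tr-loop {a} α b = Setoid.trans (fam a) (tr-irr α (Setoid.refl A) b) (tr-refl b)

  𝒲-node : {w w' : 𝕎 B} → 𝒲 B w w' → n B w ≈A n B w'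
  𝒲-node (dsup _ _ α _) = α

  -- An equality of trees yields equalities of subtrees at positions related
  -- along any proof α of equality of the roots (not only the stored one).
  𝒲-branch : {w w' : 𝕎 B} → 𝒲 B w w' → (α : n B w ≈A n B w')
             {b : B₀ B (n B w)} {b' : B₀ B (n B w')} → _≈[_]_ B b α b' →
             𝒲 B (br B w b) (br B w' b')
  𝒲-branch (dsup w w' α₀ φ) α {b} {b'} β =
    φ (b , b' , Setoid.trans (fam (n B w')) (tr-irr α₀ α b) β)

  subtrees : (w : 𝕎 B) → 𝒲 B w w → Func (fam (n B w)) (WS B)
  subtrees w p = record
    { to   = λ b → br B w b , 𝒲-branch p (𝒲-node p) (tr-loop (𝒲-node p) b)
    ; cong = λ {b} {b'} e →
        𝒲-branch p (𝒲-node p) (Setoid.trans (fam (n B w)) (tr-loop (𝒲-node p) b) e)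
    }

  us : Func (WS B) (P B (WS B))
  us = record
    { to   = λ { (w , p) → n B w , subtrees w p }
    ; cong = λ { {w , _} {w' , _} q →
        𝒲-node q , λ b → 𝒲-branch q (𝒲-node q) (Setoid.refl (fam (n B w'))) }
    }

  s∘us≈id : (s B ∘ₛ us) ≈ₑ idₛ (WS B)
  s∘us≈id (sup a f , p) = p

  -- Decomposing s (a , g) gives back a and the trees underlying g, and the
  -- equality of W only inspects underlying trees.
  us∘s≈id : (us ∘ₛ s B) ≈ₑ idₛ (P B (WS B))
  us∘s≈id x = Setoid.refl (P B (WS B)) {x}

proposition3p6 : (A : Setoid 0ℓ 0ℓ) (B : SetoidFamily A) →
    Σ (Func (WS B) (P B (WS B))) (λ us →
    ((s B ∘ₛ us) ≈ₑ idₛ (WS B)) × ((us ∘ₛ s B) ≈ₑ idₛ (P B (WS B))))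
proposition3p6 A B = us , s∘us≈id , us∘s≈id
  where open UnSup A B
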